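{- Let $R$ be a relation on $\{0,1\}$ with $R\notin IS_{12}$. Then $\langle\{R,\mathrm{OR}\}\rangle_{\max}$ is the set of all relations on $\{0,1\}$.
   Context: $IS_{12}=\langle\langle\{\mathrm{EQ},\delta_0,\delta_1\}\cup\{\mathrm{OR}^m:m\ge2\}\rangle\rangle$, where $\langle\langle\Gamma\rangle\rangle$ is the smallest set of relations on $\{0,1\}$ containing $\Gamma$ and $\mathrm{EQ}=\{(0,0),(1,1)\}$ closed under manipulations with variables (renaming, permuting, identifying variables), conjunction and existential quantification; $\delta_0=\{(0)\}$, $\delta_1=\{(1)\}$, $\mathrm{OR}^m=\{0,1\}^m\setminus\{(0,\dots,0)\}$, $\mathrm{OR}=\mathrm{OR}^2$. Max-implementation: for an $(n+m)$-ary $R$, $\exists_{\max}(y_1,\dots,y_m)R$ consists of those $\mathbf a\in\{0,1\}^n$ whose number of extensions $\mathbf b\in\{0,1\}^m$ with $(\mathbf a,\mathbf b)\in R$ is maximal over all of $\{0,1\}^n$. $\langle\Gamma\rangle_{\max}$ is the smallest set containing $\Gamma$ and $\mathrm{EQ}$, closed under manipulations with variables, conjunction and max-implementation. -}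

module Defs where

open import Data.Nat using (ℕ; zero; suc; _+_; _≡ᵇ_; _⊔_)
open import Data.Bool using (Bool; true; false; _∧_; _∨_; if_then_else_)
open import Data.Vec using (Vec; []; _∷_; _++_; lookup; tabulate; take; drop)
open import Data.Fin using (Fin)
open import Data.List as List using (List)
open import Data.Nat.ListAction using (sum)
open import Relation.Binary.PropositionalEquality using (_≡_)

-- A relation of arity n on {0,1} (false = 0, true = 1), given by its
-- (decidable) characteristic function.
BRel : ℕ → Set
BRel n = Vec Bool n → Bool

tuples : (n : ℕ) → List (Vec Bool n)
tuples zero = [] List.∷ List.[]
tuples (suc n) = List.map (false ∷_) (tuples n) List.++ List.map (true ∷_) (tuples n)

count : ∀ {n} → BRel n → ℕ
count {n} P = sum (List.map (λ v → if P v then 1 else 0) (tuples n))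

maxList : List ℕ → ℕ
maxList = List.foldr _⊔_ 0

EQ : BRel 2
EQ (x ∷ y ∷ []) = if x then y else (if y then false else true)

δ₀ : BRel 1
δ₀ (x ∷ []) = if x then false else true

δ₁ : BRel 1
δ₁ (x ∷ []) = x

ORm : (m : ℕ) → BRel m
ORm _ [] = false
ORm _ (x ∷ xs) = x ∨ ORm _ xs

OR : BRel 2
OR = ORm 2

-- Manipulation with variables: S(x₁,…,x_m) = R(x_{f 1},…,x_{f n}).
-- (covers renaming, permuting and identifying variables)
manip : ∀ {n m} → (Fin n → Fin m) → BRel n → BRel m
manip f R x = R (tabulate (λ i → lookup x (f i)))

-- Conjunction on disjoint variable sets (shared variables via manip).
conj : ∀ {n m} → BRel n → BRel m → BRel (n + m)
conj {n} R S x = R (take n x) ∧ S (drop n x)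

exist : ∀ {n} → BRel (suc n) → BRel n
exist R x = R (false ∷ x) ∨ R (true ∷ x)

numExt : ∀ {n} m → BRel (n + m) → Vec Bool n → ℕ
numExt m R a = count {m} (λ b → R (a ++ b))

maxImpl : ∀ n m → BRel (n + m) → BRel n
maxImpl n m R a = numExt m R a ≡ᵇ maxList (List.map (numExt m R) (tuples n))

-- Closures. A set of relations Γ is a predicate (n : ℕ) → BRel n → Set.
-- Sets of relations are taken up to extensional equality (constructor ext).

data PPClo (Γ : (n : ℕ) → BRel n → Set) : (n : ℕ) → BRel n → Set where
  base  : ∀ {n} {R : BRel n} → Γ n R → PPClo Γ n R
  eq    : PPClo Γ 2 EQ
  man   : ∀ {n m} {R : BRel n} (f : Fin n → Fin m) → PPClo Γ n R → PPClo Γ m (manip f R)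
  and   : ∀ {n m} {R : BRel n} {S : BRel m} → PPClo Γ n R → PPClo Γ m S → PPClo Γ (n + m) (conj R S)
  ex    : ∀ {n} {R : BRel (suc n)} → PPClo Γ (suc n) R → PPClo Γ n (exist R)
  ext   : ∀ {n} {R S : BRel n} → PPClo Γ n R → (∀ x → R x ≡ S x) → PPClo Γ n S

data MaxClo (Γ : (n : ℕ) → BRel n → Set) : (n : ℕ) → BRel n → Set where
  base  : ∀ {n} {R : BRel n} → Γ n R → MaxClo Γ n R
  eq    : MaxClo Γ 2 EQ
  man   : ∀ {n m} {R : BRel n} (f : Fin n → Fin m) → MaxClo Γ n R → MaxClo Γ m (manip f R)
  and   : ∀ {n m} {R : BRel n} {S : BRel m} → MaxClo Γ n R → MaxClo Γ m S → MaxClo Γ (n + m) (conj R S)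
  mx    : ∀ {n m} {R : BRel (n + m)} → MaxClo Γ (n + m) R → MaxClo Γ n (maxImpl n m R)
  ext   : ∀ {n} {R S : BRel n} → MaxClo Γ n R → (∀ x → R x ≡ S x) → MaxClo Γ n S

-- Generators of IS₁₂ (EQ is added by the closure itself).
data IS12Gen : (n : ℕ) → BRel n → Set where
  g-δ₀ : IS12Gen 1 δ₀
  g-δ₁ : IS12Gen 1 δ₁
  g-or : ∀ k → IS12Gen (suc (suc k)) (ORm (suc (suc k)))

IS₁₂ : (n : ℕ) → BRel n → Set
IS₁₂ = PPClo IS12Gen

data WithOR {k : ℕ} (R : BRel k) : (n : ℕ) → BRel n → Set where
  g-R  : WithOR R k R
  g-OR : WithOR R 2 OR

module Submission where

-- Let f(x,y,z) = x ∨ (y ∧ ¬z), acting coordinatewise on tuples.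
-- (A) Every relation closed under f lies in IS₁₂.  Each t ∉ R is cut off
--     by a relation of IS₁₂ containing R: the OR of the coordinates where t
--     is 0, δ₀ on one coordinate, or EQ on two; if none of these works,
--     closure under f rebuilds t from members of R.  R is the conjunction
--     of these separators.
-- (B) So R ∉ IS₁₂ has members m, y, z with f(m,y,z) ∉ R.  Identifying the
--     coordinates of R by their pattern in such tuples and pinning one class
--     to 1 (OR max-implements δ₁) gives a ternary relation in one of two
--     small explicit families; for each member a finite evaluation exhibits
--     max-implementations of δ₀ and of XOR, and XOR with OR yields MUX.
-- (C) MUX, δ₀ and δ₁ max-implement every relation of positive arity: graphs
--     of Boolean functions by Shannon expansion, then a relation as its
--     characteristic graph pinned to 1.
-- The file first develops tools (finite search, evaluating manipulations,
-- ∃max of functional projections), then (C), (B), (A); lemma28 is last.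

open import Defs
open import Data.Nat using (ℕ; zero; suc; _+_; _≤_; z≤n; s≤s; _≡ᵇ_)
open import Data.Nat.Properties using (≤-antisym; ⊔-lub; m≤m⊔n; m≤n⇒m≤o⊔n; +-identityʳ)
open import Data.Nat.ListAction using (sum)
open import Data.Bool using (Bool; true; false; _∧_; _∨_; not; if_then_else_)
open import Data.Bool.Properties using (∧-conicalˡ; ∧-conicalʳ; ∨-conicalˡ; ∨-conicalʳ; ∧-zeroʳ; ∨-zeroʳ; not-injective)
open import Data.Bool.ListAction using (any)
open import Data.Vec as V using (Vec; []; _∷_; _++_; lookup; tabulate)
open import Data.Vec.Properties using (tabulate-∘; tabulate∘lookup; tabulate-cong; lookup-++ˡ; lookup-++ʳ; lookup-zipWith; map-++; map-∘)
open import Data.Fin using (Fin; zero; suc; #_; _↑ˡ_; _↑ʳ_)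
open import Data.List as L using (List)
open import Data.List.Properties using (map-cong)
open import Data.List.Membership.Propositional using (_∈_)
open import Data.List.Membership.Propositional.Properties using (∈-map⁺; ∈-++⁺ˡ; ∈-++⁺ʳ; ∈-allFin)
open import Data.List.Relation.Unary.Any using (here; there)
open import Data.List.Relation.Unary.All as All using (All; universal)
open import Data.List.Relation.Unary.All.Properties using (map⁺)
open import Data.Product using (Σ; _×_; _,_; proj₁; proj₂)
open import Data.Sum using (_⊎_; inj₁; inj₂)
open import Function using (id)
open import Relation.Nullary using (¬_; contradiction)
open import Relation.Binary.PropositionalEquality

beq : Bool → Bool → Bool
beq true b = b
beq false b = not b

beq-refl : ∀ b → beq b b ≡ true
beq-refl true = refl
beq-refl false = refl

beq-sound : ∀ {a b} → beq a b ≡ true → a ≡ b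
beq-sound {true} {true} _ = refl
beq-sound {false} {false} _ = refl
beq-sound {true} {false} ()
beq-sound {false} {true} ()

∧-false-right : ∀ {u v} → u ∧ v ≡ false → u ≡ true → v ≡ false
∧-false-right h refl = h

EQ-beq : ∀ x y → EQ (x ∷ y ∷ []) ≡ beq x y
EQ-beq true y = refl
EQ-beq false true = refl
EQ-beq false false = refl

vec-ext : ∀ {A : Set} {k} {u v : Vec A k} → (∀ i → lookup u i ≡ lookup v i) → u ≡ v
vec-ext {u = u} {v} h = trans (sym (tabulate∘lookup u)) (trans (tabulate-cong h) (tabulate∘lookup v))

searchTuples : ∀ n {P Q : Vec Bool n → Set} → (∀ v → P v ⊎ Q v) → (∀ v → P v) ⊎ Σ (Vec Bool n) Q
searchTuples zero h with h []
... | inj₁ p = inj₁ λ { [] → p }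
... | inj₂ q = inj₂ ([] , q)
searchTuples (suc n) {P} {Q} h
  with searchTuples n {λ v → P (false ∷ v)} {λ v → Q (false ∷ v)} (λ v → h (false ∷ v))
     | searchTuples n {λ v → P (true ∷ v)} {λ v → Q (true ∷ v)} (λ v → h (true ∷ v))
... | inj₂ (v , q) | _ = inj₂ (false ∷ v , q)
... | inj₁ _ | inj₂ (v , q) = inj₂ (true ∷ v , q)
... | inj₁ p₀ | inj₁ p₁ = inj₁ λ { (false ∷ v) → p₀ v ; (true ∷ v) → p₁ v }

searchFin : ∀ n {P Q : Fin n → Set} → (∀ i → P i ⊎ Q i) → (∀ i → P i) ⊎ Σ (Fin n) Q
searchFin zero h = inj₁ (λ ())
searchFin (suc n) {P} {Q} h with h zero | searchFin n {λ i → P (suc i)} {λ i → Q (suc i)} (λ i → h (suc i))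
... | inj₂ q | _ = inj₂ (zero , q)
... | inj₁ _ | inj₂ (i , q) = inj₂ (suc i , q)
... | inj₁ p | inj₁ ps = inj₁ λ { zero → p ; (suc i) → ps i }

false-or-true : ∀ b → b ≡ false ⊎ b ≡ true
false-or-true false = inj₁ refl
false-or-true true = inj₂ refl

empty-or-inhabited : ∀ {n} (S : BRel n) → (∀ x → S x ≡ false) ⊎ Σ (Vec Bool n) (λ x → S x ≡ true)
empty-or-inhabited {n} S = searchTuples n (λ x → false-or-true (S x))

-- Evaluation of a Boolean predicate on all n-tuples; it certifies the
-- finitely many identities between explicit relations used below.
allTuples : (n : ℕ) → (Vec Bool n → Bool) → Bool
allTuples zero P = P []
allTuples (suc n) P = allTuples n (λ v → P (false ∷ v)) ∧ allTuples n (λ v → P (true ∷ v))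

allTuples-sound : ∀ n P → allTuples n P ≡ true → ∀ x → P x ≡ true
allTuples-sound zero P h [] = h
allTuples-sound (suc n) P h (false ∷ x) = allTuples-sound n _ (∧-conicalˡ _ _ h) x
allTuples-sound (suc n) P h (true ∷ x) = allTuples-sound n _ (∧-conicalʳ _ _ h) x

sameRel : ∀ n → BRel n → BRel n → Bool
sameRel n R S = allTuples n (λ x → beq (R x) (S x))

sameRel-sound : ∀ {n} {R S : BRel n} → sameRel n R S ≡ true → ∀ x → R x ≡ S x
sameRel-sound {n} h x = beq-sound (allTuples-sound n _ h x)

∈-tuples : ∀ {n} (v : Vec Bool n) → v ∈ tuples n
∈-tuples [] = here refl
∈-tuples {suc n} (false ∷ v) = ∈-++⁺ˡ (∈-map⁺ (false ∷_) (∈-tuples v))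
∈-tuples {suc n} (true ∷ v) = ∈-++⁺ʳ (L.map (false ∷_) (tuples n)) (∈-map⁺ (true ∷_) (∈-tuples v))

conj-++ : ∀ {n m} (R : BRel n) (S : BRel m) (x : Vec Bool n) (y : Vec Bool m) → conj R S (x ++ y) ≡ R x ∧ S y
conj-++ R S x y = cong₂ _∧_ (cong R (take-++ x y)) (cong S (drop-++ x y))
  where
    take-++ : ∀ {n m} (x : Vec Bool n) (y : Vec Bool m) → V.take n (x ++ y) ≡ x
    take-++ [] y = refl
    take-++ (b ∷ x) y = cong (b ∷_) (take-++ x y)
    drop-++ : ∀ {n m} (x : Vec Bool n) (y : Vec Bool m) → V.drop n (x ++ y) ≡ y
    drop-++ [] y = refl
    drop-++ (b ∷ x) y = drop-++ x y

manip-lookup : ∀ {n m} (pos : Vec (Fin m) n) (R : BRel n) (x : Vec Bool m) → manip (lookup pos) R x ≡ R (V.map (lookup x) pos)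
manip-lookup pos R x = cong R (trans (tabulate-∘ (lookup x) (lookup pos)) (cong (V.map (lookup x)) (tabulate∘lookup pos)))

map-lookup-tabulate : ∀ {A : Set} {n m} (f : Fin n → Fin m) (x : Vec A m) (y : Vec A n) →
                      (∀ j → lookup x (f j) ≡ lookup y j) → V.map (lookup x) (tabulate f) ≡ y
map-lookup-tabulate f x y h = trans (sym (tabulate-∘ (lookup x) f)) (trans (tabulate-cong h) (tabulate∘lookup y))

ind : Bool → ℕ
ind b = if b then 1 else 0

count-cong : ∀ {n} {P Q : BRel n} → (∀ v → P v ≡ Q v) → count P ≡ count Q
count-cong {n} h = cong sum (map-cong (λ v → cong ind (h v)) (tuples n))

maxList-upper : ∀ {x xs} → x ∈ xs → x ≤ maxList xs
maxList-upper {xs = y L.∷ ys} (here refl) = m≤m⊔n y (maxList ys)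
maxList-upper {xs = y L.∷ ys} (there p) = m≤n⇒m≤o⊔n y (maxList-upper p)

maxList-least : ∀ {b xs} → All (_≤ b) xs → maxList xs ≤ b
maxList-least All.[] = z≤n
maxList-least (p All.∷ ps) = ⊔-lub p (maxList-least ps)

-- If every a has exactly ind (h a) extensions in T and h is inhabited, then
-- the maximal number of extensions is 1, so ∃max projects T onto h.
maxImpl-functional : ∀ n m (T : BRel (n + m)) (h : BRel n) → (∀ a → numExt m T a ≡ ind (h a)) →
                     ∀ {a₀} → h a₀ ≡ true → ∀ a → maxImpl n m T a ≡ h a
maxImpl-functional n m T h exts {a₀} ha₀ a = trans (cong₂ _≡ᵇ_ (exts a) max≡1) (ind-≡ᵇ-1 (h a))
  where
    ind≤1 : ∀ b → ind b ≤ 1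
    ind≤1 true = s≤s z≤n
    ind≤1 false = z≤n
    ind-≡ᵇ-1 : ∀ b → (ind b ≡ᵇ 1) ≡ b
    ind-≡ᵇ-1 true = refl
    ind-≡ᵇ-1 false = refl
    exts≤1 : ∀ a → numExt m T a ≤ 1
    exts≤1 a = subst (_≤ 1) (sym (exts a)) (ind≤1 (h a))
    max≡1 : maxList (L.map (numExt m T) (tuples n)) ≡ 1
    max≡1 = ≤-antisym (maxList-least (map⁺ (universal exts≤1 (tuples n))))
                      (subst (_≤ _) (trans (exts a₀) (cong ind ha₀)) (maxList-upper (∈-map⁺ (numExt m T) (∈-tuples a₀))))

project : ∀ {Γ} n m {T : BRel (n + m)} {h : BRel n} → MaxClo Γ (n + m) T →
          (∀ a → numExt m T a ≡ ind (h a)) → ∀ {a₀} → h a₀ ≡ true → MaxClo Γ n h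
project n m {T} {h} T∈ exts ha₀ = ext (mx T∈) (maxImpl-functional n m T h exts ha₀)

-- With δ₁, pinning the first variable to 1 preserves max-implementability
-- (for a non-empty result): S(1,x) is the projection of δ₁(c) ∧ S(c,x) along c.
pin-true : ∀ {Γ n} {S : BRel (suc n)} → MaxClo Γ 1 δ₁ → MaxClo Γ (suc n) S →
           ∀ {x₀} → S (true ∷ x₀) ≡ true → MaxClo Γ n (λ x → S (true ∷ x))
pin-true {Γ} {n} {S} δ₁∈ S∈ = project n 1 (man (lookup pos) (and δ₁∈ S∈)) exts
  where
    c : Fin (n + 1)
    c = n ↑ʳ zero
    pos : Vec (Fin (n + 1)) (1 + suc n)
    pos = c ∷ c ∷ tabulate (_↑ˡ 1)
    T-eval : ∀ x (v : Vec Bool 1) → manip (lookup pos) (conj δ₁ S) (x ++ v) ≡ V.head v ∧ S (V.head v ∷ x)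
    T-eval x (b ∷ []) = trans (manip-lookup pos (conj δ₁ S) (x ++ b ∷ []))
      (cong₂ (λ u y → u ∧ S (u ∷ y)) (lookup-++ʳ x (b ∷ []) zero)
             (map-lookup-tabulate _ (x ++ b ∷ []) x (lookup-++ˡ x (b ∷ []))))
    exts : ∀ x → numExt 1 (manip (lookup pos) (conj δ₁ S)) x ≡ ind (S (true ∷ x))
    exts x = trans (count-cong (T-eval x)) (+-identityʳ _)

MUX : BRel 4
MUX (s ∷ a ∷ b ∷ w ∷ []) = beq w (if s then b else a)

graph : ∀ {n} → (Vec Bool n → Bool) → BRel (suc n)
graph g (w ∷ x) = beq w (g x)

pointAnd : Bool → Bool → (Bool → Bool → Bool) → BRel 2
pointAnd c₀ c₁ φ (u₀ ∷ u₁ ∷ []) = beq u₀ c₀ ∧ (beq u₁ c₁ ∧ φ u₀ u₁)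

count-pointAnd : ∀ c₀ c₁ φ → count (pointAnd c₀ c₁ φ) ≡ ind (φ c₀ c₁)
count-pointAnd false false φ = +-identityʳ _
count-pointAnd false true φ = +-identityʳ _
count-pointAnd true false φ = +-identityʳ _
count-pointAnd true true φ = +-identityʳ _

module Universality {Γ : (n : ℕ) → BRel n → Set}
  (mux∈ : MaxClo Γ 4 MUX) (δ₀∈ : MaxClo Γ 1 δ₀) (δ₁∈ : MaxClo Γ 1 δ₁) where

  constant∈ : ∀ b → MaxClo Γ 1 (graph {0} (λ _ → b))
  constant∈ true = ext δ₁∈ (λ { (false ∷ []) → refl ; (true ∷ []) → refl })
  constant∈ false = ext δ₀∈ (λ { (false ∷ []) → refl ; (true ∷ []) → refl })

  -- Shannon expansion: g(x₀,x') = MUX(x₀, g(0,x'), g(1,x')).  In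
  --   T(w,x₀,x',u₀,u₁) = graph g₀ (u₀,x') ∧ graph g₁ (u₁,x') ∧ MUX(x₀,u₀,u₁,w)
  -- the auxiliary u₀, u₁ are determined by x', so ∃max projects them away.
  graph∈ : ∀ n (g : Vec Bool n → Bool) → MaxClo Γ (suc n) (graph g)
  graph∈ zero g = ext (constant∈ (g [])) (λ { (w ∷ []) → refl })
  graph∈ (suc n) g =
    project (suc (suc n)) 2 {h = graph g} T∈ exts {g (false ∷ zeros) ∷ false ∷ zeros} (beq-refl (g (false ∷ zeros)))
    where
      g₀ g₁ : Vec Bool n → Bool
      g₀ x = g (false ∷ x)
      g₁ x = g (true ∷ x)
      x'-pos : Vec (Fin (suc (suc n) + 2)) n
      x'-pos = tabulate (λ j → suc (suc (j ↑ˡ 2)))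
      u₀-pos u₁-pos : Fin (suc (suc n) + 2)
      u₀-pos = suc (suc (n ↑ʳ zero))
      u₁-pos = suc (suc (n ↑ʳ suc zero))
      pos : Vec (Fin (suc (suc n) + 2)) (suc n + (suc n + 4))
      pos = (u₀-pos ∷ x'-pos) ++ ((u₁-pos ∷ x'-pos) ++ (suc zero ∷ u₀-pos ∷ u₁-pos ∷ zero ∷ []))
      T : BRel (suc (suc n) + 2)
      T = manip (lookup pos) (conj (graph g₀) (conj (graph g₁) MUX))
      T∈ : MaxClo Γ (suc (suc n) + 2) T
      T∈ = man (lookup pos) (and (graph∈ n g₀) (and (graph∈ n g₁) mux∈))
      T-eval : ∀ w x₀ x' (u : Vec Bool 2) →
               T ((w ∷ x₀ ∷ x') ++ u) ≡ pointAnd (g₀ x') (g₁ x') (λ u₀ u₁ → MUX (x₀ ∷ u₀ ∷ u₁ ∷ w ∷ [])) u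
      T-eval w x₀ x' (u₀ ∷ u₁ ∷ []) =
        begin
          T y
        ≡⟨ manip-lookup pos (conj (graph g₀) (conj (graph g₁) MUX)) y ⟩
          conj (graph g₀) (conj (graph g₁) MUX) (V.map (lookup y) pos)
        ≡⟨ cong (conj (graph g₀) (conj (graph g₁) MUX)) read ⟩
          conj (graph g₀) (conj (graph g₁) MUX) ((u₀ ∷ x') ++ ((u₁ ∷ x') ++ mux-args))
        ≡⟨ conj-++ (graph g₀) (conj (graph g₁) MUX) (u₀ ∷ x') ((u₁ ∷ x') ++ mux-args) ⟩
          beq u₀ (g₀ x') ∧ conj (graph g₁) MUX ((u₁ ∷ x') ++ mux-args)
        ≡⟨ cong (beq u₀ (g₀ x') ∧_) (conj-++ (graph g₁) MUX (u₁ ∷ x') mux-args) ⟩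
          beq u₀ (g₀ x') ∧ (beq u₁ (g₁ x') ∧ MUX mux-args)
        ∎
        where
          open ≡-Reasoning
          y : Vec Bool (suc (suc n) + 2)
          y = (w ∷ x₀ ∷ x') ++ (u₀ ∷ u₁ ∷ [])
          mux-args : Vec Bool 4
          mux-args = x₀ ∷ u₀ ∷ u₁ ∷ w ∷ []
          read-x' : V.map (lookup y) x'-pos ≡ x'
          read-x' = map-lookup-tabulate _ y x' (lookup-++ˡ x' (u₀ ∷ u₁ ∷ []))
          read : V.map (lookup y) pos ≡ (u₀ ∷ x') ++ ((u₁ ∷ x') ++ mux-args)
          read rewrite map-++ (lookup y) (u₀-pos ∷ x'-pos) ((u₁-pos ∷ x'-pos) ++ (suc zero ∷ u₀-pos ∷ u₁-pos ∷ zero ∷ []))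
                     | map-++ (lookup y) (u₁-pos ∷ x'-pos) (suc zero ∷ u₀-pos ∷ u₁-pos ∷ zero ∷ [])
                     | read-x' | lookup-++ʳ x' (u₀ ∷ u₁ ∷ []) zero | lookup-++ʳ x' (u₀ ∷ u₁ ∷ []) (suc zero) = refl
      exts : ∀ a → numExt 2 T a ≡ ind (graph g a)
      exts (w ∷ false ∷ x') = trans (count-cong (T-eval w false x')) (count-pointAnd (g₀ x') (g₁ x') (λ u₀ _ → beq w u₀))
      exts (w ∷ true ∷ x') = trans (count-cong (T-eval w true x')) (count-pointAnd (g₀ x') (g₁ x') (λ _ u₁ → beq w u₁))
      zeros : Vec Bool n
      zeros = V.replicate n false

  -- A non-empty S is its graph pinned to w = 1; an empty S is δ₀ ∧ δ₁ on
  -- the first variable.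
  every∈ : ∀ n (S : BRel (suc n)) → MaxClo Γ (suc n) S
  every∈ n S with empty-or-inhabited S
  ... | inj₁ empty = ext (man (λ _ → zero) (and δ₀∈ δ₁∈)) contradictory
    where
      contradictory : ∀ x → manip (λ _ → zero) (conj δ₀ δ₁) x ≡ S x
      contradictory (false ∷ x) = sym (empty _)
      contradictory (true ∷ x) = sym (empty _)
  ... | inj₂ (x₀ , Sx₀) = pin-true δ₁∈ (graph∈ (suc n) S) Sx₀

IMP NAND XOR : BRel 2
IMP (x ∷ y ∷ []) = not x ∨ y
NAND (x ∷ y ∷ []) = not (x ∧ y)
XOR (x ∷ y ∷ []) = not (beq x y)

clause : Bool → Bool → Bool → BRel 3
clause t₁ t₂ t₃ (x₁ ∷ x₂ ∷ x₃ ∷ []) = not (beq x₁ t₁ ∧ (beq x₂ t₂ ∧ beq x₃ t₃))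

literal : Bool → BRel 2
literal true = IMP
literal false = NAND

-- The clause excluding (t₁,t₂,t₃) as ∃max over y₁, y₂, y₃ of six literal
-- constraints between the yᵢ and x₁, x₂, x₃ (correct by evaluation).
clause-pos : Vec (Fin 6) 12
clause-pos = # 3 ∷ # 0 ∷ # 4 ∷ # 0 ∷ # 4 ∷ # 1 ∷ # 5 ∷ # 0 ∷ # 5 ∷ # 1 ∷ # 5 ∷ # 2 ∷ []

clauseFormula : Bool → Bool → Bool → BRel 3
clauseFormula t₁ t₂ t₃ = maxImpl 3 3 (manip (lookup clause-pos)
  (conj (literal (not t₁)) (conj (literal t₁) (conj (literal (not t₂)) (conj (literal t₁) (conj (literal t₂) (literal (not t₃))))))))

clauseFormula-correct : ∀ t₁ t₂ t₃ → sameRel 3 (clauseFormula t₁ t₂ t₃) (clause t₁ t₂ t₃) ≡ true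
clauseFormula-correct false false false = refl
clauseFormula-correct false false true = refl
clauseFormula-correct false true false = refl
clauseFormula-correct false true true = refl
clauseFormula-correct true false false = refl
clauseFormula-correct true false true = refl
clauseFormula-correct true true false = refl
clauseFormula-correct true true true = refl

-- MUX(s,a,b,w) in conjunctive normal form: the clauses on (s,a,w)
-- excluding (0,0,1), (0,1,0) and on (s,b,w) excluding (1,0,1), (1,1,0).
mux-pos : Vec (Fin 4) 12
mux-pos = # 0 ∷ # 1 ∷ # 3 ∷ # 0 ∷ # 1 ∷ # 3 ∷ # 0 ∷ # 2 ∷ # 3 ∷ # 0 ∷ # 2 ∷ # 3 ∷ []

mux-cnf : sameRel 4 (manip (lookup mux-pos) (conj (clause false false true) (conj (clause false true false)
                       (conj (clause true false true) (clause true true false))))) MUX ≡ true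
mux-cnf = refl

record Recipe (i o : ℕ) : Set₁ where
  field
    apply   : BRel i → BRel o
    realize : ∀ {Γ} → MaxClo Γ 2 OR → ∀ {S} → MaxClo Γ i S → MaxClo Γ o (apply S)
open Recipe

reaches : ∀ {i o} → List (Recipe i o) → BRel i → BRel o → Bool
reaches {o = o} rs S T = any (λ r → sameRel o (apply r S) T) rs

reaches-sound : ∀ {Γ i o} (rs : List (Recipe i o)) {S : BRel i} {T : BRel o} →
                MaxClo Γ 2 OR → MaxClo Γ i S → reaches rs S T ≡ true → MaxClo Γ o T
reaches-sound L.[] or∈ S∈ ()
reaches-sound {o = o} (r L.∷ rs) {S} {T} or∈ S∈ h with sameRel o (apply r S) T in same
... | true = ext (realize r or∈ S∈) (sameRel-sound same)
... | false = reaches-sound rs or∈ S∈ h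

-- ∃max y. S(y, x, y).
diagonal : Recipe 3 1
diagonal = record
  { apply = λ S → maxImpl 1 1 (manip (lookup pos) S)
  ; realize = λ or∈ S∈ → mx {n = 1} {m = 1} (man (lookup pos) S∈) }
  where
    pos : Vec (Fin 2) 3
    pos = # 1 ∷ # 0 ∷ # 1 ∷ []

-- ∃max y. S(…) ∧ OR(…) with arguments at the given positions among x and
-- m auxiliary variables y.
withOR : ∀ m → Vec (Fin (1 + m)) 5 → Recipe 3 1
withOR m pos = record
  { apply = λ S → maxImpl 1 m (manip (lookup pos) (conj S OR))
  ; realize = λ or∈ S∈ → mx {n = 1} {m = m} (man (lookup pos) (and S∈ or∈)) }

δ₀-recipes : List (Recipe 3 1)
δ₀-recipes = diagonal L.∷ withOR 3 (# 1 ∷ # 0 ∷ # 2 ∷ # 1 ∷ # 3 ∷ [])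
  L.∷ withOR 3 (# 1 ∷ # 2 ∷ # 0 ∷ # 1 ∷ # 3 ∷ []) L.∷ withOR 2 (# 0 ∷ # 1 ∷ # 2 ∷ # 1 ∷ # 1 ∷ [])
  L.∷ withOR 2 (# 0 ∷ # 1 ∷ # 2 ∷ # 1 ∷ # 2 ∷ []) L.∷ L.[]

-- XOR from a binary B: B itself, OR(x,y) ∧ B(x,y), or
-- ∃max u v. OR(x,y) ∧ B(u,x) ∧ B(v,y).
xor-recipes : List (Recipe 2 2)
xor-recipes = itself L.∷ orAnd L.∷ orAndTwice L.∷ L.[]
  where
    itself orAnd orAndTwice : Recipe 2 2
    itself = record { apply = λ B → B ; realize = λ _ B∈ → B∈ }
    orAnd = record
      { apply = λ B → manip (lookup pos) (conj OR B)
      ; realize = λ or∈ B∈ → man (lookup pos) (and or∈ B∈) }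
      where
        pos : Vec (Fin 2) 4
        pos = # 0 ∷ # 1 ∷ # 0 ∷ # 1 ∷ []
    orAndTwice = record
      { apply = λ B → maxImpl 2 2 (manip (lookup pos) (conj OR (conj B B)))
      ; realize = λ or∈ B∈ → mx {n = 2} {m = 2} (man (lookup pos) (and or∈ (and B∈ B∈))) }
      where
        pos : Vec (Fin 4) 6
        pos = # 0 ∷ # 1 ∷ # 2 ∷ # 0 ∷ # 3 ∷ # 1 ∷ []

-- ∃max r. S(x,y,r) ∧ δ₀(r), i.e. S(x,y,0) when that is non-empty.
atZero : BRel 3 → BRel 2
atZero S = maxImpl 2 1 (manip (lookup (# 0 ∷ # 1 ∷ # 2 ∷ # 2 ∷ [])) (conj S δ₀))

productive : BRel 3 → Bool
productive S = reaches δ₀-recipes S δ₀ ∧ reaches xor-recipes (atZero S) XOR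

table : (b₀₀₀ b₀₀₁ b₀₁₀ b₀₁₁ b₁₀₀ b₁₀₁ b₁₁₀ b₁₁₁ : Bool) → BRel 3
table b₀₀₀ b₀₀₁ b₀₁₀ b₀₁₁ b₁₀₀ b₁₀₁ b₁₁₀ b₁₁₁ (false ∷ false ∷ false ∷ []) = b₀₀₀
table b₀₀₀ b₀₀₁ b₀₁₀ b₀₁₁ b₁₀₀ b₁₀₁ b₁₁₀ b₁₁₁ (false ∷ false ∷ true ∷ []) = b₀₀₁
table b₀₀₀ b₀₀₁ b₀₁₀ b₀₁₁ b₁₀₀ b₁₀₁ b₁₁₀ b₁₁₁ (false ∷ true ∷ false ∷ []) = b₀₁₀
table b₀₀₀ b₀₀₁ b₀₁₀ b₀₁₁ b₁₀₀ b₁₀₁ b₁₁₀ b₁₁₁ (false ∷ true ∷ true ∷ []) = b₀₁₁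
table b₀₀₀ b₀₀₁ b₀₁₀ b₀₁₁ b₁₀₀ b₁₀₁ b₁₁₀ b₁₁₁ (true ∷ false ∷ false ∷ []) = b₁₀₀
table b₀₀₀ b₀₀₁ b₀₁₀ b₀₁₁ b₁₀₀ b₁₀₁ b₁₁₀ b₁₁₁ (true ∷ false ∷ true ∷ []) = b₁₀₁
table b₀₀₀ b₀₀₁ b₀₁₀ b₀₁₁ b₁₀₀ b₁₀₁ b₁₁₀ b₁₁₁ (true ∷ true ∷ false ∷ []) = b₁₁₀
table b₀₀₀ b₀₀₁ b₀₁₀ b₀₁₁ b₁₀₀ b₁₀₁ b₁₁₀ b₁₁₁ (true ∷ true ∷ true ∷ []) = b₁₁₁

-- S(1,0,0) = S(0,1,0) = 1 and S(1,1,0) = 0: the union of two members is missing.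
joinMissing : Vec Bool 5 → BRel 3
joinMissing (b₀₀₀ ∷ b₀₀₁ ∷ b₀₁₁ ∷ b₁₀₁ ∷ b₁₁₁ ∷ []) = table b₀₀₀ b₀₀₁ true b₀₁₁ true b₁₀₁ false b₁₁₁

joinMissing-fits : ∀ (S : BRel 3) → S (true ∷ false ∷ false ∷ []) ≡ true → S (false ∷ true ∷ false ∷ []) ≡ true →
  S (true ∷ true ∷ false ∷ []) ≡ false → Σ (Vec Bool 5) λ w → ∀ x → S x ≡ joinMissing w x
joinMissing-fits S s₁₀₀ s₀₁₀ s₁₁₀ = rows , fits
  where
    rows : Vec Bool 5
    rows = S (false ∷ false ∷ false ∷ []) ∷ S (false ∷ false ∷ true ∷ []) ∷
           S (false ∷ true ∷ true ∷ []) ∷ S (true ∷ false ∷ true ∷ []) ∷ S (true ∷ true ∷ true ∷ []) ∷ []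
    fits : ∀ x → S x ≡ joinMissing rows x
    fits (false ∷ false ∷ false ∷ []) = refl
    fits (false ∷ false ∷ true ∷ []) = refl
    fits (false ∷ true ∷ false ∷ []) = s₀₁₀
    fits (false ∷ true ∷ true ∷ []) = refl
    fits (true ∷ false ∷ false ∷ []) = s₁₀₀
    fits (true ∷ false ∷ true ∷ []) = refl
    fits (true ∷ true ∷ false ∷ []) = s₁₁₀
    fits (true ∷ true ∷ true ∷ []) = refl

-- S(0,0,0) = S(1,0,0) = S(1,1,0) = 1 and S(0,1,0) = 0, the pattern of
-- m, m ∨ z, m ∨ z ∨ y and f(m,y,z) when these are the only distinctions.
fMissing : Vec Bool 4 → BRel 3
fMissing (b₀₀₁ ∷ b₀₁₁ ∷ b₁₀₁ ∷ b₁₁₁ ∷ []) = table true b₀₀₁ false b₀₁₁ true b₁₀₁ true b₁₁₁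

fMissing-fits : ∀ (S : BRel 3) → S (false ∷ false ∷ false ∷ []) ≡ true → S (true ∷ false ∷ false ∷ []) ≡ true →
  S (true ∷ true ∷ false ∷ []) ≡ true → S (false ∷ true ∷ false ∷ []) ≡ false →
  Σ (Vec Bool 4) λ w → ∀ x → S x ≡ fMissing w x
fMissing-fits S s₀₀₀ s₁₀₀ s₁₁₀ s₀₁₀ = rows , fits
  where
    rows : Vec Bool 4
    rows = S (false ∷ false ∷ true ∷ []) ∷ S (false ∷ true ∷ true ∷ []) ∷
           S (true ∷ false ∷ true ∷ []) ∷ S (true ∷ true ∷ true ∷ []) ∷ []
    fits : ∀ x → S x ≡ fMissing rows x
    fits (false ∷ false ∷ false ∷ []) = s₀₀₀
    fits (false ∷ false ∷ true ∷ []) = refl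
    fits (false ∷ true ∷ false ∷ []) = s₀₁₀
    fits (false ∷ true ∷ true ∷ []) = refl
    fits (true ∷ false ∷ false ∷ []) = s₁₀₀
    fits (true ∷ false ∷ true ∷ []) = refl
    fits (true ∷ true ∷ false ∷ []) = s₁₁₀
    fits (true ∷ true ∷ true ∷ []) = refl

joinMissing-productive : allTuples 5 (λ w → productive (joinMissing w)) ≡ true
joinMissing-productive = refl

fMissing-productive : allTuples 4 (λ w → productive (fMissing w)) ≡ true
fMissing-productive = refl

-- The polymorphism f(x,y,z) = x ∨ (y ∧ ¬z) of IS₁₂, coordinatewise.
f₁₂ : Bool → Bool → Bool → Bool
f₁₂ x y z = x ∨ (y ∧ not z)

fop : ∀ {k} → Vec Bool k → Vec Bool k → Vec Bool k → Vec Bool k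
fop [] [] [] = []
fop (x ∷ a) (y ∷ b) (z ∷ c) = f₁₂ x y z ∷ fop a b c

lookup-fop : ∀ {k} (a b c : Vec Bool k) i → lookup (fop a b c) i ≡ f₁₂ (lookup a i) (lookup b i) (lookup c i)
lookup-fop (x ∷ a) (y ∷ b) (z ∷ c) zero = refl
lookup-fop (x ∷ a) (y ∷ b) (z ∷ c) (suc i) = lookup-fop a b c i

vor : ∀ {k} → Vec Bool k → Vec Bool k → Vec Bool k
vor = V.zipWith _∨_

fop-self : ∀ {k} (a b : Vec Bool k) → fop a b a ≡ vor a b
fop-self [] [] = refl
fop-self (true ∷ a) (y ∷ b) = cong (true ∷_) (fop-self a b)
fop-self (false ∷ a) (true ∷ b) = cong (true ∷_) (fop-self a b)
fop-self (false ∷ a) (false ∷ b) = cong (false ∷_) (fop-self a b)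

Closed : ∀ {k} → BRel k → Set
Closed {k} R = ∀ (a b c : Vec Bool k) → R a ≡ true → R b ≡ true → R c ≡ true → R (fop a b c) ≡ true

Violation : ∀ {k} → BRel k → Set
Violation {k} R = Σ (Vec Bool k) λ a → Σ (Vec Bool k) λ b → Σ (Vec Bool k) λ c →
  R a ≡ true × R b ≡ true × R c ≡ true × R (fop a b c) ≡ false

classify-eval : ∀ {k} (R : BRel k) (cls : Fin k → Fin 4) (v : Vec Bool 4) (t : Vec Bool k) →
                (∀ i → lookup v (cls i) ≡ lookup t i) → manip cls R v ≡ R t
classify-eval R cls v t h = cong R (trans (tabulate-cong h) (tabulate∘lookup t))

-- Classes of a coordinate by its values (a_i, b_i) in two tuples; the
-- first class (1,1) will be pinned to 1.
pairClass : Bool → Bool → Fin 4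
pairClass true true = # 0
pairClass true false = # 1
pairClass false true = # 2
pairClass false false = # 3

PairReads : Bool → Bool → Set
PairReads a b = lookup (true ∷ true ∷ false ∷ false ∷ []) (pairClass a b) ≡ a
              × lookup (true ∷ false ∷ true ∷ false ∷ []) (pairClass a b) ≡ b
              × lookup (true ∷ true ∷ true ∷ false ∷ []) (pairClass a b) ≡ a ∨ b

pairClass-reads : ∀ a b → PairReads a b
pairClass-reads true true = refl , refl , refl
pairClass-reads true false = refl , refl , refl
pairClass-reads false true = refl , refl , refl
pairClass-reads false false = refl , refl , refl

-- Classes of a coordinate by (m_i, y_i, z_i): m_i = 1, else z_i = 1, else
-- y_i = 1, else none; the first class will be pinned to 1.
fClass : Bool → Bool → Bool → Fin 4
fClass true y z = # 0
fClass false y true = # 1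
fClass false true false = # 2
fClass false false false = # 3

FReads : Bool → Bool → Bool → Set
FReads m y z = lookup (true ∷ false ∷ false ∷ false ∷ []) (fClass m y z) ≡ m
             × lookup (true ∷ true ∷ false ∷ false ∷ []) (fClass m y z) ≡ m ∨ z
             × lookup (true ∷ true ∷ true ∷ false ∷ []) (fClass m y z) ≡ (m ∨ z) ∨ y
             × lookup (true ∷ false ∷ true ∷ false ∷ []) (fClass m y z) ≡ f₁₂ m y z

fClass-reads : ∀ m y z → FReads m y z
fClass-reads true y z = refl , refl , refl , refl
fClass-reads false true true = refl , refl , refl , refl
fClass-reads false false true = refl , refl , refl , refl
fClass-reads false true false = refl , refl , refl , refl
fClass-reads false false false = refl , refl , refl , refl

module FromOR {Γ : (n : ℕ) → BRel n → Set} (or∈ : MaxClo Γ 2 OR) where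

  -- δ₁(x) = ∃max y. OR(x,y): x = 1 has two extensions, x = 0 one.
  δ₁∈ : MaxClo Γ 1 δ₁
  δ₁∈ = ext (mx {n = 1} {m = 1} or∈) λ { (false ∷ []) → refl ; (true ∷ []) → refl }

  -- IMP(x,y) = ∃max z. XOR(x,z) ∧ OR(z,y); NAND(x,y) = ∃max z. XOR(y,z) ∧
  -- IMP(x,z); then the clauses and MUX by clauseFormula and mux-cnf.
  mux-from-xor : MaxClo Γ 2 XOR → MaxClo Γ 4 MUX
  mux-from-xor xor∈ = ext (man (lookup mux-pos) (and (clause∈ false false true) (and (clause∈ false true false)
                            (and (clause∈ true false true) (clause∈ true true false))))) (sameRel-sound mux-cnf)
    where
      imp∈ : MaxClo Γ 2 IMP
      imp∈ = ext (mx {n = 2} {m = 1} (man (lookup (# 0 ∷ # 2 ∷ # 2 ∷ # 1 ∷ [])) (and xor∈ or∈))) (sameRel-sound refl)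
      nand∈ : MaxClo Γ 2 NAND
      nand∈ = ext (mx {n = 2} {m = 1} (man (lookup (# 1 ∷ # 2 ∷ # 0 ∷ # 2 ∷ [])) (and xor∈ imp∈))) (sameRel-sound refl)
      literal∈ : ∀ b → MaxClo Γ 2 (literal b)
      literal∈ true = imp∈
      literal∈ false = nand∈
      clause∈ : ∀ t₁ t₂ t₃ → MaxClo Γ 3 (clause t₁ t₂ t₃)
      clause∈ t₁ t₂ t₃ = ext (mx {n = 3} {m = 3} (man (lookup clause-pos)
        (and (literal∈ (not t₁)) (and (literal∈ t₁) (and (literal∈ (not t₂))
          (and (literal∈ t₁) (and (literal∈ t₂) (literal∈ (not t₃))))))))) (sameRel-sound (clauseFormula-correct t₁ t₂ t₃))

  Goal : Set
  Goal = MaxClo Γ 4 MUX × MaxClo Γ 1 δ₀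

  productive-sound : ∀ {S} → MaxClo Γ 3 S → productive S ≡ true → Goal
  productive-sound {S} S∈ h = mux-from-xor xor∈ , δ₀∈
    where
      δ₀∈ : MaxClo Γ 1 δ₀
      δ₀∈ = reaches-sound δ₀-recipes or∈ S∈ (∧-conicalˡ _ _ h)
      atZero∈ : MaxClo Γ 2 (atZero S)
      atZero∈ = mx {n = 2} {m = 1} (man (lookup (# 0 ∷ # 1 ∷ # 2 ∷ # 2 ∷ [])) (and S∈ δ₀∈))
      xor∈ : MaxClo Γ 2 XOR
      xor∈ = reaches-sound xor-recipes or∈ atZero∈ (∧-conicalʳ _ _ h)

  from-family : ∀ {m S} (family : Vec Bool m → BRel 3) → allTuples m (λ w → productive (family w)) ≡ true →
                MaxClo Γ 3 S → Σ (Vec Bool m) (λ w → ∀ x → S x ≡ family w x) → Goal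
  from-family {m} family all S∈ (w , fits) =
    productive-sound (ext S∈ fits) (allTuples-sound m (λ w → productive (family w)) all w)

  pinned : ∀ {k} → BRel k → (Fin k → Fin 4) → BRel 3
  pinned R cls x = manip cls R (true ∷ x)

  pinned∈ : ∀ {k} {R : BRel k} cls → MaxClo Γ k R → ∀ {x₀} → pinned R cls x₀ ≡ true → MaxClo Γ 3 (pinned R cls)
  pinned∈ cls R∈ = pin-true δ₁∈ (man cls R∈)

  -- u, v ∈ R with u ∨ v ∉ R: the pinned classification of R by (u_i, v_i)
  -- belongs to joinMissing.
  from-join : ∀ {k} {R : BRel k} → MaxClo Γ k R → (u v : Vec Bool k) →
              R u ≡ true → R v ≡ true → R (vor u v) ≡ false → Goal
  from-join {k} {R} R∈ u v Ru Rv Ru∨v =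
    from-family joinMissing joinMissing-productive (pinned∈ cls R∈ s₁₀₀) (joinMissing-fits S s₁₀₀ s₀₁₀ s₁₁₀)
    where
      cls : Fin k → Fin 4
      cls i = pairClass (lookup u i) (lookup v i)
      S : BRel 3
      S = pinned R cls
      reads : ∀ i → PairReads (lookup u i) (lookup v i)
      reads i = pairClass-reads (lookup u i) (lookup v i)
      s₁₀₀ : S (true ∷ false ∷ false ∷ []) ≡ true
      s₁₀₀ = trans (classify-eval R cls (true ∷ true ∷ false ∷ false ∷ []) u (λ i → proj₁ (reads i))) Ru
      s₀₁₀ : S (false ∷ true ∷ false ∷ []) ≡ true
      s₀₁₀ = trans (classify-eval R cls (true ∷ false ∷ true ∷ false ∷ []) v (λ i → proj₁ (proj₂ (reads i)))) Rv
      s₁₁₀ : S (true ∷ true ∷ false ∷ []) ≡ false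
      s₁₁₀ = trans (classify-eval R cls (true ∷ true ∷ true ∷ false ∷ []) (vor u v) (λ i → trans (proj₂ (proj₂ (reads i))) (sym (lookup-zipWith _∨_ i u v)))) Ru∨v

  -- m, m ∨ z, m ∨ z ∨ y ∈ R and f(m,y,z) ∉ R: the classification by
  -- (m_i, y_i, z_i) belongs to fMissing.
  from-f : ∀ {k} {R : BRel k} → MaxClo Γ k R → (m y z : Vec Bool k) → R m ≡ true → R (vor m z) ≡ true →
           R (vor (vor m z) y) ≡ true → R (fop m y z) ≡ false → Goal
  from-f {k} {R} R∈ m y z Rm Rm∨z Rm∨z∨y Rf =
    from-family fMissing fMissing-productive (pinned∈ cls R∈ s₀₀₀) (fMissing-fits S s₀₀₀ s₁₀₀ s₁₁₀ s₀₁₀)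
    where
      cls : Fin k → Fin 4
      cls i = fClass (lookup m i) (lookup y i) (lookup z i)
      S : BRel 3
      S = pinned R cls
      reads : ∀ i → FReads (lookup m i) (lookup y i) (lookup z i)
      reads i = fClass-reads (lookup m i) (lookup y i) (lookup z i)
      s₀₀₀ : S (false ∷ false ∷ false ∷ []) ≡ true
      s₀₀₀ = trans (classify-eval R cls (true ∷ false ∷ false ∷ false ∷ []) m (λ i → proj₁ (reads i))) Rm
      s₁₀₀ : S (true ∷ false ∷ false ∷ []) ≡ true
      s₁₀₀ = trans (classify-eval R cls (true ∷ true ∷ false ∷ false ∷ []) (vor m z)
                      (λ i → trans (proj₁ (proj₂ (reads i))) (sym (lookup-zipWith _∨_ i m z)))) Rm∨z
      s₁₁₀ : S (true ∷ true ∷ false ∷ []) ≡ true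
      s₁₁₀ = trans (classify-eval R cls (true ∷ true ∷ true ∷ false ∷ []) (vor (vor m z) y)
                      (λ i → trans (proj₁ (proj₂ (proj₂ (reads i))))
                        (sym (trans (lookup-zipWith _∨_ i (vor m z) y) (cong (_∨ lookup y i) (lookup-zipWith _∨_ i m z)))))) Rm∨z∨y
      s₀₁₀ : S (false ∷ true ∷ false ∷ []) ≡ false
      s₀₁₀ = trans (classify-eval R cls (true ∷ false ∷ true ∷ false ∷ []) (fop m y z)
                      (λ i → trans (proj₂ (proj₂ (proj₂ (reads i)))) (sym (lookup-fop m y z i)))) Rf

  -- A violation of closure under f: if m ∨ z ∉ R or m ∨ z ∨ y ∉ R the
  -- union of two members is missing, otherwise from-f applies.
  from-violation : ∀ {k} {R : BRel k} → MaxClo Γ k R → Violation R → Goal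
  from-violation {R = R} R∈ (m , y , z , Rm , Ry , Rz , Rf) with R (vor m z) in Rm∨z
  ... | false = from-join R∈ m z Rm Rz Rm∨z
  ... | true with R (vor (vor m z) y) in Rm∨z∨y
  ... | false = from-join R∈ (vor m z) y Rm∨z Ry Rm∨z∨y
  ... | true = from-f R∈ m y z Rm Rm∨z Rm∨z∨y Rf

closed-or-violated : ∀ {k} (R : BRel k) → Closed R ⊎ Violation R
closed-or-violated {k} R = searchTuples k λ a → searchTuples k λ b → searchTuples k λ c → triple a b c
  where
    triple : ∀ a b c → (R a ≡ true → R b ≡ true → R c ≡ true → R (fop a b c) ≡ true)
                     ⊎ (R a ≡ true × R b ≡ true × R c ≡ true × R (fop a b c) ≡ false)
    triple a b c with R a | R b | R c | R (fop a b c)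
    ... | false | _ | _ | _ = inj₁ (λ ())
    ... | true | false | _ | _ = inj₁ (λ _ ())
    ... | true | true | false | _ = inj₁ (λ _ _ ())
    ... | true | true | true | true = inj₁ (λ _ _ _ → refl)
    ... | true | true | true | false = inj₂ (refl , refl , refl , refl)

full∈ : ∀ k → IS₁₂ k (λ _ → true)
full∈ k = ext (man (λ ()) (ex (ex eq))) (λ x → refl)

-- OR⁰ is empty: ∃x. δ₀(x) ∧ δ₁(x); OR¹ is δ₁.
ORm∈ : ∀ r → IS₁₂ r (ORm r)
ORm∈ zero = ext (ex (man (λ _ → zero) (and (base g-δ₀) (base g-δ₁)))) (λ { [] → refl })
ORm∈ (suc zero) = ext (base g-δ₁) (λ { (true ∷ []) → refl ; (false ∷ []) → refl })
ORm∈ (suc (suc r)) = base (g-or r)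

meet∈ : ∀ {k} {C D : BRel k} → IS₁₂ k C → IS₁₂ k D → IS₁₂ k (λ x → C x ∧ D x)
meet∈ {k} {C} {D} C∈ D∈ = ext (man (lookup twice) (and C∈ D∈)) meet
  where
    twice : Vec (Fin k) (k + k)
    twice = tabulate id ++ tabulate id
    meet : ∀ x → manip (lookup twice) (conj C D) x ≡ C x ∧ D x
    meet x = trans (manip-lookup twice (conj C D) x) (trans (cong (conj C D) read) (conj-++ C D x x))
      where
        read-id : V.map (lookup x) (tabulate id) ≡ x
        read-id = map-lookup-tabulate id x x (λ _ → refl)
        read : V.map (lookup x) twice ≡ x ++ x
        read = trans (map-++ (lookup x) (tabulate id) (tabulate id)) (cong₂ _++_ read-id read-id)

_⊑_ : ∀ {k} → Vec Bool k → Vec Bool k → Set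
x ⊑ t = ∀ i → lookup t i ≡ false → lookup x i ≡ false

-- outside t x = 1 iff x has a 1 where t has a 0, i.e. x ⋢ t; it is an OR
-- of the coordinates where t vanishes.
outside : ∀ {k} → Vec Bool k → Vec Bool k → Bool
outside [] [] = false
outside (true ∷ t) (_ ∷ x) = outside t x
outside (false ∷ t) (x₀ ∷ x) = x₀ ∨ outside t x

zeroPositions : ∀ {k} → Vec Bool k → Σ ℕ (λ r → Vec (Fin k) r)
zeroPositions [] = 0 , []
zeroPositions (true ∷ t) = proj₁ (zeroPositions t) , V.map suc (proj₂ (zeroPositions t))
zeroPositions (false ∷ t) = suc (proj₁ (zeroPositions t)) , zero ∷ V.map suc (proj₂ (zeroPositions t))

outside-as-OR : ∀ {k} (t x : Vec Bool k) → ORm _ (V.map (lookup x) (proj₂ (zeroPositions t))) ≡ outside t x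
outside-as-OR [] [] = refl
outside-as-OR (true ∷ t) (x₀ ∷ x) =
  trans (cong (ORm _) (sym (map-∘ (lookup (x₀ ∷ x)) suc (proj₂ (zeroPositions t))))) (outside-as-OR t x)
outside-as-OR (false ∷ t) (x₀ ∷ x) =
  cong (x₀ ∨_) (trans (cong (ORm _) (sym (map-∘ (lookup (x₀ ∷ x)) suc (proj₂ (zeroPositions t))))) (outside-as-OR t x))

outside∈ : ∀ {k} (t : Vec Bool k) → IS₁₂ k (outside t)
outside∈ t = ext (man (lookup ps) (ORm∈ _)) (λ x → trans (manip-lookup ps (ORm _) x) (outside-as-OR t x))
  where ps = proj₂ (zeroPositions t)

outside-self : ∀ {k} (t : Vec Bool k) → outside t t ≡ false
outside-self [] = refl
outside-self (true ∷ t) = outside-self t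
outside-self (false ∷ t) = outside-self t

outside-⊑ : ∀ {k} (t a : Vec Bool k) → outside t a ≡ false → a ⊑ t
outside-⊑ (true ∷ t) (_ ∷ a) h zero ()
outside-⊑ (true ∷ t) (_ ∷ a) h (suc i) ti = outside-⊑ t a h i ti
outside-⊑ (false ∷ t) (a₀ ∷ a) h zero _ = ∨-conicalˡ a₀ _ h
outside-⊑ (false ∷ t) (a₀ ∷ a) h (suc i) ti = outside-⊑ t a (∨-conicalʳ a₀ _ h) i ti

module ClosedUnderF {k : ℕ} (R : BRel k) (closed : Closed R) where

  ∨-closed : ∀ u v → R u ≡ true → R v ≡ true → R (vor u v) ≡ true
  ∨-closed u v Ru Rv = subst (λ w → R w ≡ true) (fop-self u v) (closed u v u Ru Rv Ru)

  -- t ∈ R as soon as R contains some a ⊑ t, a tuple with a 1 at every j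
  -- where t_j = 1, and a tuple separating i and j whenever t_i = 0, t_j = 1.
  module Rebuild (t a : Vec Bool k) (Ra : R a ≡ true) (a⊑t : a ⊑ t)
    (ones : ∀ j → lookup t j ≡ true → Σ (Vec Bool k) λ b → R b ≡ true × lookup b j ≡ true)
    (splits : ∀ i j → lookup t i ≡ false → lookup t j ≡ true →
              Σ (Vec Bool k) λ c → R c ≡ true × beq (lookup c i) (lookup c j) ≡ false) where

    Shrinks : Vec Bool k → Vec Bool k → Set
    Shrinks y' y = ∀ l → lookup t l ≡ false → lookup y' l ≡ true → lookup y l ≡ true

    module AtOne (j : Fin k) (tj : lookup t j ≡ true) (aj : lookup a j ≡ false) where

      -- A member z with z_j = 0 and z_i = 1: the separator c of i and j,
      -- or f(a,y,c) if c has its 1 at j.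
      opposite : ∀ y → R y ≡ true → lookup y j ≡ true → ∀ i → lookup t i ≡ false → lookup y i ≡ true →
                 Σ (Vec Bool k) λ z → R z ≡ true × lookup z j ≡ false × lookup z i ≡ true
      opposite y Ry yj i ti yi with splits i j ti tj
      ... | c , Rc , ci≠cj with lookup c i in ci | lookup c j in cj
      ... | true | false = c , Rc , cj , ci
      ... | false | true = fop a y c , closed a y c Ra Ry Rc , zj , zi
        where
          zj : lookup (fop a y c) j ≡ false
          zj rewrite lookup-fop a y c j | aj | yj | cj = refl
          zi : lookup (fop a y c) i ≡ true
          zi rewrite lookup-fop a y c i | a⊑t i ti | yi | ci = refl

      clear-one : ∀ y → R y ≡ true → lookup y j ≡ true → ∀ i → lookup t i ≡ false → lookup y i ≡ true →
                  Σ (Vec Bool k) λ y' → R y' ≡ true × lookup y' j ≡ true × lookup y' i ≡ false × Shrinks y' y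
      clear-one y Ry yj i ti yi with opposite y Ry yj i ti yi
      ... | z , Rz , zj , zi = fop a y z , closed a y z Ra Ry Rz , keeps , clears , shrinks
        where
          keeps : lookup (fop a y z) j ≡ true
          keeps rewrite lookup-fop a y z j | aj | yj | zj = refl
          clears : lookup (fop a y z) i ≡ false
          clears rewrite lookup-fop a y z i | a⊑t i ti | zi = ∧-zeroʳ (lookup y i)
          shrinks : Shrinks (fop a y z) y
          shrinks l tl h rewrite lookup-fop a y z l | a⊑t l tl = ∧-conicalˡ (lookup y l) _ h

      clear-all : ∀ (is : List (Fin k)) y → R y ≡ true → lookup y j ≡ true →
                  Σ (Vec Bool k) λ y' → R y' ≡ true × lookup y' j ≡ true ×
                    (∀ i → i ∈ is → lookup t i ≡ false → lookup y' i ≡ false) × Shrinks y' y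
      clear-all L.[] y Ry yj = y , Ry , yj , (λ { _ () _ }) , (λ _ _ h → h)
      clear-all (i L.∷ is) y Ry yj with clear-all is y Ry yj
      ... | y₁ , R₁ , j₁ , cleared₁ , shrinks₁ with lookup t i in ti | lookup y₁ i in yi
      ... | true | _ = y₁ , R₁ , j₁ , cleared , shrinks₁
        where
          cleared : ∀ i' → i' ∈ (i L.∷ is) → lookup t i' ≡ false → lookup y₁ i' ≡ false
          cleared i' (here refl) h = contradiction (trans (sym ti) h) λ ()
          cleared i' (there p) h = cleared₁ i' p h
      ... | false | false = y₁ , R₁ , j₁ , cleared , shrinks₁
        where
          cleared : ∀ i' → i' ∈ (i L.∷ is) → lookup t i' ≡ false → lookup y₁ i' ≡ false
          cleared i' (here refl) _ = yi
          cleared i' (there p) h = cleared₁ i' p h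
      ... | false | true with clear-one y₁ R₁ j₁ i ti yi
      ... | y₂ , R₂ , j₂ , i₂ , shrinks₂ = y₂ , R₂ , j₂ , cleared , (λ l tl h → shrinks₁ l tl (shrinks₂ l tl h))
        where
          cleared : ∀ i' → i' ∈ (i L.∷ is) → lookup t i' ≡ false → lookup y₂ i' ≡ false
          cleared i' (here refl) _ = i₂
          cleared i' (there p) h with lookup y₂ i' in e
          ... | false = refl
          ... | true = contradiction (trans (sym (shrinks₂ i' h e)) (cleared₁ i' p h)) λ ()

    witness : ∀ j → lookup t j ≡ true → Σ (Vec Bool k) λ d → R d ≡ true × lookup d j ≡ true × d ⊑ t
    witness j tj with lookup a j in aj
    ... | true = a , Ra , aj , a⊑t
    ... | false with ones j tj
    ... | b , Rb , bj with AtOne.clear-all j tj aj (L.allFin k) b Rb bj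
    ... | d , Rd , dj , cleared , _ = d , Rd , dj , (λ i ti → cleared i (∈-allFin i) ti)

    join-witnesses : ∀ (js : List (Fin k)) → Σ (Vec Bool k) λ s → R s ≡ true × s ⊑ t ×
                     (∀ j → j ∈ js → lookup t j ≡ true → lookup s j ≡ true)
    join-witnesses L.[] = a , Ra , a⊑t , (λ { _ () _ })
    join-witnesses (j L.∷ js) with join-witnesses js | false-or-true (lookup t j)
    ... | s , Rs , s⊑t , covers | inj₁ tj = s , Rs , s⊑t , covers'
      where
        covers' : ∀ j' → j' ∈ (j L.∷ js) → lookup t j' ≡ true → lookup s j' ≡ true
        covers' j' (here refl) h = contradiction (trans (sym h) tj) λ ()
        covers' j' (there p) h = covers j' p h
    ... | s , Rs , s⊑t , covers | inj₂ tj with witness j tj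
    ... | d , Rd , dj , d⊑t = vor s d , ∨-closed s d Rs Rd , below , covers'
      where
        below : vor s d ⊑ t
        below l tl rewrite lookup-zipWith _∨_ l s d | s⊑t l tl | d⊑t l tl = refl
        covers' : ∀ j' → j' ∈ (j L.∷ js) → lookup t j' ≡ true → lookup (vor s d) j' ≡ true
        covers' j' (here refl) _ rewrite lookup-zipWith _∨_ j' s d | dj = ∨-zeroʳ (lookup s j')
        covers' j' (there p) h rewrite lookup-zipWith _∨_ j' s d | covers j' p h = refl

    rebuild : R t ≡ true
    rebuild with join-witnesses (L.allFin k)
    ... | s , Rs , s⊑t , covers = subst (λ w → R w ≡ true) (vec-ext agree) Rs
      where
        agree : ∀ l → lookup s l ≡ lookup t l
        agree l with lookup t l in tl
        ... | true = covers l (∈-allFin l) tl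
        ... | false = s⊑t l tl

  Separator : Vec Bool k → Set
  Separator t = Σ (BRel k) λ C → IS₁₂ k C × C t ≡ false × (∀ x → R x ≡ true → C x ≡ true)

  zero-column : ∀ t j → (lookup t j ≡ true → Σ (Vec Bool k) λ b → R b ≡ true × lookup b j ≡ true)
                      ⊎ (lookup t j ≡ true × (∀ x → R x ≡ true → lookup x j ≡ false))
  zero-column t j with false-or-true (lookup t j) | empty-or-inhabited (λ b → R b ∧ lookup b j)
  ... | inj₁ tj | _ = inj₁ λ tj' → contradiction (trans (sym tj') tj) λ ()
  ... | inj₂ tj | inj₁ none = inj₂ (tj , λ x Rx → ∧-false-right (none x) Rx)
  ... | inj₂ _ | inj₂ (b , hb) = inj₁ λ _ → b , ∧-conicalˡ _ _ hb , ∧-conicalʳ _ _ hb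

  equal-columns : ∀ t i j → (lookup t i ≡ false → lookup t j ≡ true →
                              Σ (Vec Bool k) λ c → R c ≡ true × beq (lookup c i) (lookup c j) ≡ false)
                          ⊎ (lookup t i ≡ false × lookup t j ≡ true × (∀ x → R x ≡ true → beq (lookup x i) (lookup x j) ≡ true))
  equal-columns t i j with false-or-true (lookup t i) | false-or-true (lookup t j)
                         | empty-or-inhabited (λ c → R c ∧ not (beq (lookup c i) (lookup c j)))
  ... | inj₂ ti | _ | _ = inj₁ λ ti' → contradiction (trans (sym ti) ti') λ ()
  ... | inj₁ _ | inj₁ tj | _ = inj₁ λ _ tj' → contradiction (trans (sym tj) tj') λ ()
  ... | inj₁ ti | inj₂ tj | inj₁ none = inj₂ (ti , tj , λ x Rx → not-injective (∧-false-right (none x) Rx))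
  ... | inj₁ _ | inj₂ _ | inj₂ (c , hc) = inj₁ λ _ _ → c , ∧-conicalˡ _ _ hc , not-injective (∧-conicalʳ _ _ hc)

  -- Every t ∉ R has a separator: outside t if no member of R lies below t;
  -- δ₀ at j if t_j = 1 but all members vanish at j; EQ at (i, j) if
  -- t_i = 0, t_j = 1 and no member separates i from j.  If none of these
  -- applies, rebuild yields t ∈ R.
  separate : ∀ t → R t ≡ false → Separator t
  separate t Rt with empty-or-inhabited (λ a → R a ∧ not (outside t a))
  ... | inj₁ none-below = outside t , outside∈ t , outside-self t ,
          λ x Rx → not-injective (∧-false-right (none-below x) Rx)
  ... | inj₂ (a , ha) with searchFin k (zero-column t)
  ...   | inj₂ (j , tj , vanish) =
          (λ x → δ₀ (lookup x j ∷ [])) , man (λ _ → j) (base g-δ₀) ,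
          cong (λ b → δ₀ (b ∷ [])) tj , (λ x Rx → cong (λ b → δ₀ (b ∷ [])) (vanish x Rx))
  ...   | inj₁ ones with searchFin k (λ i → searchFin k (equal-columns t i))
  ...     | inj₂ (i , j , ti , tj , equal) =
          (λ x → EQ (lookup x i ∷ lookup x j ∷ [])) , man pair eq ,
          trans (EQ-beq (lookup t i) (lookup t j)) (cong₂ beq ti tj) ,
          (λ x Rx → trans (EQ-beq (lookup x i) (lookup x j)) (equal x Rx))
    where
      pair : Fin 2 → Fin k
      pair zero = i
      pair (suc _) = j
  ...     | inj₁ splits = contradiction (trans (sym (Rebuild.rebuild t a Ra a⊑t ones splits)) Rt) λ ()
    where
      Ra : R a ≡ true
      Ra = ∧-conicalˡ _ _ ha
      a⊑t : a ⊑ t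
      a⊑t = outside-⊑ t a (not-injective (∧-conicalʳ _ _ ha))


  cut : ∀ t → Σ (BRel k) λ C → IS₁₂ k C × (R t ≡ false → C t ≡ false) × (∀ x → R x ≡ true → C x ≡ true)
  cut t with R t in Rt
  ... | true = (λ _ → true) , full∈ k , (λ ()) , (λ _ _ → refl)
  ... | false with separate t Rt
  ...   | C , C∈ , Ct , R⊆C = C , C∈ , (λ _ → Ct) , R⊆C

  cuts : List (Vec Bool k) → BRel k
  cuts L.[] x = true
  cuts (t L.∷ ts) x = proj₁ (cut t) x ∧ cuts ts x

  cuts∈ : ∀ ts → IS₁₂ k (cuts ts)
  cuts∈ L.[] = full∈ k
  cuts∈ (t L.∷ ts) = meet∈ (proj₁ (proj₂ (cut t))) (cuts∈ ts)

  cuts-contain : ∀ ts x → R x ≡ true → cuts ts x ≡ true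
  cuts-contain L.[] x Rx = refl
  cuts-contain (t L.∷ ts) x Rx rewrite proj₂ (proj₂ (proj₂ (cut t))) x Rx = cuts-contain ts x Rx

  cuts-exclude : ∀ ts x → R x ≡ false → x ∈ ts → cuts ts x ≡ false
  cuts-exclude (t L.∷ ts) x Rx (here refl) rewrite proj₁ (proj₂ (proj₂ (cut x))) Rx = refl
  cuts-exclude (t L.∷ ts) x Rx (there p) rewrite cuts-exclude ts x Rx p = ∧-zeroʳ _

  closed⇒IS₁₂ : IS₁₂ k R
  closed⇒IS₁₂ = ext (cuts∈ (tuples k)) is-R
    where
      is-R : ∀ x → cuts (tuples k) x ≡ R x
      is-R x with R x in Rx
      ... | true = cuts-contain (tuples k) x Rx
      ... | false = cuts-exclude (tuples k) x Rx (∈-tuples x)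
lemma28 : (k : ℕ) (R : BRel k) → ¬ IS₁₂ k R →
    (n : ℕ) (S : BRel (suc n)) → MaxClo (WithOR R) (suc n) S
lemma28 k R R∉IS₁₂ n S with closed-or-violated R
... | inj₁ closed = contradiction (ClosedUnderF.closed⇒IS₁₂ R closed) R∉IS₁₂
... | inj₂ violation with FromOR.from-violation (base g-OR) (base g-R) violation
...   | mux∈ , δ₀∈ = Universality.every∈ mux∈ δ₀∈ (FromOR.δ₁∈ (base g-OR)) n S
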